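{- Let $G=(V,E)$ be a graph, let $E_0$ be a non-empty subset of $E$, let $E'=E\setminus E_0$ and $G'=(V,E')$. Then $|q^*(G)-q^*(G')|<2|E_0|/|E|$.
   Context: For a graph $G$ with $m\ge 1$ edges and a vertex partition $\mathcal A$, $q_{\mathcal A}(G)=\frac1m\sum_{A\in\mathcal A}e(A)-\frac{1}{4m^2}\sum_{A\in\mathcal A}\mathrm{vol}(A)^2$ ($e(A)$: number of edges within $A$; $\mathrm{vol}(A)$: sum of degrees in $A$); $q^*(G)=\max_{\mathcal A}q_{\mathcal A}(G)$ over all vertex partitions, and by convention $q^*(G)=0$ if $G$ has no edges. -}

module Defs where

open import Data.Nat as ℕ using (ℕ; zero; suc)
open import Data.Bool using (Bool; true; false; _∧_; not; if_then_else_)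
open import Data.Fin using (Fin; zero; suc; toℕ; _≟_)
open import Data.List using (List; []; _∷_; map; concatMap; foldr; allFin)
open import Data.Nat.ListAction using (sum)
open import Data.Integer using (+_)
open import Data.Rational using (ℚ; _/_; _-_; _*_; _⊔_; 0ℚ)
open import Relation.Binary.PropositionalEquality using (_≡_)
open import Relation.Nullary.Decidable using (⌊_⌋)
open import Data.Product using (∃₂)

record Graph (n : ℕ) : Set where
  field
    adj    : Fin n → Fin n → Bool
    symm   : ∀ i j → adj i j ≡ adj j i
    irrefl : ∀ i → adj i i ≡ false
open Graph public

count : List Bool → ℕ
count []           = 0
count (true  ∷ bs) = suc (count bs)
count (false ∷ bs) = count bs

edgesWhere : ∀ {n} → (Fin n → Fin n → Bool) → ℕ
edgesWhere {n} r =
  count (concatMap (λ i → map (λ j → ⌊ toℕ i ℕ.<? toℕ j ⌋ ∧ r i j) (allFin n)) (allFin n))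

numEdges : ∀ {n} → Graph n → ℕ
numEdges G = edgesWhere (adj G)

degree : ∀ {n} → Graph n → Fin n → ℕ
degree {n} G i = count (map (adj G i) (allFin n))

-- A vertex partition is represented by a labelling c : Fin n → Fin n;
-- the blocks are the non-empty fibres c⁻¹(k). (Every partition of an
-- n-element set arises this way; empty fibres contribute 0 below.)
Labelling : ℕ → Set
Labelling n = Fin n → Fin n

inBlock : ∀ {n} → Labelling n → Fin n → Fin n → Bool
inBlock c k i = ⌊ c i ≟ k ⌋

eBlock : ∀ {n} → Graph n → Labelling n → Fin n → ℕ
eBlock G c k = edgesWhere (λ i j → inBlock c k i ∧ inBlock c k j ∧ adj G i j)

volBlock : ∀ {n} → Graph n → Labelling n → Fin n → ℕ
volBlock {n} G c k = sum (map (λ i → if inBlock c k i then degree G i else 0) (allFin n))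

-- division of naturals into ℚ (only used with nonzero denominators)
_÷_ : ℕ → ℕ → ℚ
a ÷ zero    = 0ℚ
a ÷ suc d   = (+ a) / suc d

modularity : ∀ {n} → Graph n → Labelling n → ℚ
modularity {n} G c =
  (sum (map (eBlock G c) (allFin n)) ÷ m)
  - (sum (map (λ k → volBlock G c k ℕ.* volBlock G c k) (allFin n)) ÷ (4 ℕ.* m ℕ.* m))
  where m = numEdges G

allFuns : (k n : ℕ) → List (Fin k → Fin n)
allFuns zero    n = (λ ()) ∷ []
allFuns (suc k) n =
  concatMap (λ f → map (λ a → λ { zero → a ; (suc i) → f i }) (allFin n)) (allFuns k n)

maxModularity : ∀ {n} → Graph n → ℚ
maxModularity {n} G with numEdges G
... | zero  = 0ℚ
... | suc _ = foldr _⊔_ (modularity G (λ i → i)) (map (modularity G) (allFuns n n))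

record EdgeSubset {n : ℕ} (G : Graph n) : Set where
  field
    sel    : Fin n → Fin n → Bool
    symm   : ∀ i j → sel i j ≡ sel j i
    sub    : ∀ i j → sel i j ≡ true → adj G i j ≡ true
open EdgeSubset public

NonEmptyEdges : ∀ {n} {G : Graph n} → EdgeSubset G → Set
NonEmptyEdges E₀ = ∃₂ λ i j → sel E₀ i j ≡ true

deleteEdges : ∀ {n} (G : Graph n) → EdgeSubset G → Graph n
deleteEdges G E₀ = record
  { adj    = λ i j → adj G i j ∧ not (sel E₀ i j)
  ; symm   = λ i j → cong₂' (symm G i j) (EdgeSubset.symm E₀ i j)
  ; irrefl = λ i → irr i
  }
  where
    open import Relation.Binary.PropositionalEquality using (cong₂; refl)
    cong₂' : ∀ {a b c d : Bool} → a ≡ b → c ≡ d → a ∧ not c ≡ b ∧ not d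
    cong₂' p q = cong₂ (λ x y → x ∧ not y) p q
    irr : ∀ i → adj G i i ∧ not (sel E₀ i i) ≡ false
    irr i rewrite Graph.irrefl G i = refl

edgeCount : ∀ {n} {G : Graph n} → EdgeSubset G → ℕ
edgeCount E₀ = edgesWhere (sel E₀)

module Submission where

-- Let G' = (V , E ∖ E₀), P = |E ∖ E₀|, K = |E₀| ≥ 1 and M = P + K = |E|.  Since
-- q*(G) and q*(G') are maxima over the same finite set of partitions, it suffices
-- to show that for every single partition q_A(G) and q_A(G') differ by less than
-- 2K/M in both directions (Maxima).  For a partition with x = Σ e'(A), d = Σ e₀(A),
-- S = Σ vol(A)² and S' = Σ vol'(A)², we have q_A(G) = (x + d)/M − S/(4M²) and
-- q_A(G') = x/P − S'/(4P²), and both inequalities follow, after clearing the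
-- denominator 4M²P², from: d ≤ K, x ≤ P, S' ≤ S, 2P ≤ S' ≤ 2P(P + x) (because
-- vol(A) ≤ m + e(A)), and P S ≤ M S' + 4MPK (splitting vol(A) = vol'(A) + vol₀(A)
-- with a weighted square inequality and Σ vol₀(A) = 2K).  If P = 0 then q_A(G') = 0
-- and |q_A(G)| < 2 directly.

open import Defs

module FiniteSums where
  open import Data.Nat using (ℕ; zero; suc; _+_; _*_; _≤_; z≤n)
  open import Data.Nat.Properties
    using (+-*-semiring; +-mono-≤; +-monoʳ-≤; ≤-trans; m≤m+n; m≤n+m; ≤-reflexive)
  open import Data.Fin using (Fin; zero; suc)
  open import Relation.Binary.PropositionalEquality using (_≡_; trans)
  open import Data.Nat.Tactic.RingSolver using (solve-∀)
  open import Algebra.Properties.Semiring.Sum +-*-semiring public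
    using (sum; sum-syntax; sum-cong-≗; sum-replicate-zero; ∑-distrib-+; ∑-comm;
           *-distribˡ-sum; *-distribʳ-sum)

  ∑-mono-≤ : ∀ {n} {f g : Fin n → ℕ} → (∀ i → f i ≤ g i) → sum f ≤ sum g
  ∑-mono-≤ {zero}  f≤g = z≤n
  ∑-mono-≤ {suc n} f≤g = +-mono-≤ (f≤g zero) (∑-mono-≤ (λ i → f≤g (suc i)))

  ∑-term-≤ : ∀ {n} (f : Fin n → ℕ) (i : Fin n) → f i ≤ sum f
  ∑-term-≤ f zero    = m≤m+n _ _
  ∑-term-≤ f (suc i) = ≤-trans (∑-term-≤ (λ j → f (suc j)) i) (m≤n+m _ _)

  ∑-squares-≤ : ∀ {n} (f : Fin n → ℕ) → sum (λ i → f i * f i) ≤ sum f * sum f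
  ∑-squares-≤ {zero}  f = z≤n
  ∑-squares-≤ {suc n} f =
    ≤-trans (+-monoʳ-≤ (a * a) (∑-squares-≤ (λ i → f (suc i))))
            (≤-trans (m≤m+n (a * a + s * s) (2 * a * s)) (≤-reflexive (square-+ a s)))
    where
    a s : ℕ
    a = f zero
    s = sum (λ i → f (suc i))
    square-+ : ∀ a s → a * a + s * s + 2 * a * s ≡ (a + s) * (a + s)
    square-+ = solve-∀

  ∑∑-distrib-+ : ∀ {n} (f g : Fin n → Fin n → ℕ) →
    ∑[ i < n ] ∑[ j < n ] (f i j + g i j) ≡ ∑[ i < n ] ∑[ j < n ] f i j + ∑[ i < n ] ∑[ j < n ] g i j
  ∑∑-distrib-+ {n} f g = trans (sum-cong-≗ (λ i → ∑-distrib-+ (f i) (g i)))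
                               (∑-distrib-+ (λ i → ∑[ j < n ] f i j) (λ i → ∑[ j < n ] g i j))

module Counting where
  open FiniteSums
  open import Data.Nat as ℕ using (ℕ; zero; suc; _+_; _*_)
  open import Data.Nat.Properties using (+-identityʳ)
  open import Data.Bool using (Bool; true; false; _∧_; if_then_else_)
  open import Data.Fin using (Fin; zero; suc; toℕ)
  open import Data.List using (List; []; _∷_; _++_; map; concatMap; allFin; tabulate)
  open import Data.List.Properties using (map-tabulate)
  import Data.Nat.ListAction as List
  open import Relation.Nullary.Decidable using (⌊_⌋)
  open import Relation.Binary.PropositionalEquality using (_≡_; refl; sym; cong; trans)
  open import Function using (_∘_; id)

  𝟙 : Bool → ℕ
  𝟙 true  = 1
  𝟙 false = 0

  -- The strict order on vertices used to count each edge once.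
  below : ∀ {n} → Fin n → Fin n → Bool
  below i j = ⌊ toℕ i ℕ.<? toℕ j ⌋

  count-++ : ∀ (bs cs : List Bool) → count (bs ++ cs) ≡ count bs + count cs
  count-++ []           cs = refl
  count-++ (true  ∷ bs) cs = cong suc (count-++ bs cs)
  count-++ (false ∷ bs) cs = count-++ bs cs

  count-concatMap : ∀ {A : Set} (h : A → List Bool) (xs : List A) →
                    count (concatMap h xs) ≡ List.sum (map (count ∘ h) xs)
  count-concatMap h []       = refl
  count-concatMap h (x ∷ xs) =
    trans (count-++ (h x) _) (cong (count (h x) +_) (count-concatMap h xs))

  count-tabulate : ∀ {n} (b : Fin n → Bool) → count (tabulate b) ≡ ∑[ i < n ] 𝟙 (b i)
  count-tabulate {zero}  b = refl
  count-tabulate {suc n} b with b zero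
  ... | true  = cong suc (count-tabulate (b ∘ suc))
  ... | false = count-tabulate (b ∘ suc)

  listSum-tabulate : ∀ {n} (f : Fin n → ℕ) → List.sum (tabulate f) ≡ ∑[ i < n ] f i
  listSum-tabulate {zero}  f = refl
  listSum-tabulate {suc n} f = cong (f zero +_) (listSum-tabulate (f ∘ suc))

  count-allFin : ∀ {n} (b : Fin n → Bool) → count (map b (allFin n)) ≡ ∑[ i < n ] 𝟙 (b i)
  count-allFin b = trans (cong count (map-tabulate id b)) (count-tabulate b)

  listSum-allFin : ∀ {n} (f : Fin n → ℕ) → List.sum (map f (allFin n)) ≡ ∑[ i < n ] f i
  listSum-allFin f = trans (cong List.sum (map-tabulate id f)) (listSum-tabulate f)

  edgesWhere-as-sum : ∀ {n} (r : Fin n → Fin n → Bool) →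
    edgesWhere r ≡ ∑[ i < n ] ∑[ j < n ] 𝟙 (below i j ∧ r i j)
  edgesWhere-as-sum {n} r =
    trans (count-concatMap row (allFin n))
          (trans (listSum-allFin (count ∘ row))
                 (sum-cong-≗ (λ i → count-allFin (λ j → below i j ∧ r i j))))
    where
    row : Fin n → List Bool
    row i = map (λ j → below i j ∧ r i j) (allFin n)

  degree-as-sum : ∀ {n} (H : Graph n) (i : Fin n) → degree H i ≡ ∑[ j < n ] 𝟙 (adj H i j)
  degree-as-sum H i = count-allFin (adj H i)

  if-as-product : ∀ b x → (if b then x else 0) ≡ 𝟙 b * x
  if-as-product true  x = sym (+-identityʳ x)
  if-as-product false x = refl

  volBlock-as-sum : ∀ {n} (H : Graph n) (c : Labelling n) (k : Fin n) →
    volBlock H c k ≡ ∑[ i < n ] (𝟙 (inBlock c k i) * degree H i)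
  volBlock-as-sum H c k =
    trans (listSum-allFin (λ i → if inBlock c k i then degree H i else 0))
          (sum-cong-≗ (λ i → if-as-product (inBlock c k i) (degree H i)))

module Blocks where
  open FiniteSums
  open Counting
  open import Data.Nat as ℕ using (ℕ; zero; suc; _+_; _*_; _≤_; z≤n; s≤s)
  open import Data.Nat.Properties
    using (+-identityʳ; *-identityˡ; <-asym; ≮⇒≥; ≤-antisym; ≤-<-connex; <-irrefl; +-mono-<;
           <-≤-trans; module ≤-Reasoning)
  open import Data.Nat.Tactic.RingSolver using (solve-∀)
  open import Data.Bool using (Bool; true; false; _∧_)
  open import Data.Fin using (Fin; zero; suc; toℕ) renaming (_≟_ to _≟ᶠ_)
  open import Data.Fin.Properties using (toℕ-injective)
  open import Data.Sum using (inj₁; inj₂)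
  open import Data.Empty using (⊥-elim)
  open import Relation.Nullary using (yes; no)
  open import Relation.Nullary.Decidable using (⌊_⌋)
  open import Relation.Binary.PropositionalEquality
    using (_≡_; refl; sym; cong; cong₂; trans; module ≡-Reasoning)

  orderedPairs : ∀ {n} → (Fin n → Fin n → Bool) → ℕ
  orderedPairs {n} r = ∑[ i < n ] ∑[ j < n ] 𝟙 (r i j)

  split-ordered-pair : ∀ {n} (r : Fin n → Fin n → Bool) →
    (∀ i j → r i j ≡ r j i) → (∀ i → r i i ≡ false) →
    ∀ i j → 𝟙 (r i j) ≡ 𝟙 (below i j ∧ r i j) + 𝟙 (below j i ∧ r j i)
  split-ordered-pair r symm irrefl i j with toℕ i ℕ.<? toℕ j | toℕ j ℕ.<? toℕ i
  ... | yes i<j | yes j<i = ⊥-elim (<-asym i<j j<i)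
  ... | yes _   | no  _   = sym (+-identityʳ _)
  ... | no  _   | yes _   = cong 𝟙 (symm i j)
  ... | no  i≮j | no  j≮i with toℕ-injective (≤-antisym (≮⇒≥ j≮i) (≮⇒≥ i≮j))
  ... | refl rewrite irrefl i = refl

  handshake : ∀ {n} (r : Fin n → Fin n → Bool) →
    (∀ i j → r i j ≡ r j i) → (∀ i → r i i ≡ false) →
    orderedPairs r ≡ edgesWhere r + edgesWhere r
  handshake {n} r symm irrefl = begin
    orderedPairs r
      ≡⟨ sum-cong-≗ (λ i → sum-cong-≗ (split-ordered-pair r symm irrefl i)) ⟩
    ∑[ i < n ] ∑[ j < n ] (once i j + once j i)
      ≡⟨ sum-cong-≗ (λ i → ∑-distrib-+ (once i) (λ j → once j i)) ⟩
    ∑[ i < n ] (∑[ j < n ] once i j + ∑[ j < n ] once j i)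
      ≡⟨ ∑-distrib-+ (λ i → ∑[ j < n ] once i j) (λ i → ∑[ j < n ] once j i) ⟩
    ∑[ i < n ] ∑[ j < n ] once i j + ∑[ i < n ] ∑[ j < n ] once j i
      ≡⟨ cong (∑[ i < n ] ∑[ j < n ] once i j +_) (∑-comm (λ i j → once j i)) ⟩
    ∑[ i < n ] ∑[ j < n ] once i j + ∑[ i < n ] ∑[ j < n ] once i j
      ≡⟨ sym (cong₂ _+_ (edgesWhere-as-sum r) (edgesWhere-as-sum r)) ⟩
    edgesWhere r + edgesWhere r ∎
    where
    open ≡-Reasoning
    once : Fin n → Fin n → ℕ
    once i j = 𝟙 (below i j ∧ r i j)

  handshake-graph : ∀ {n} (H : Graph n) → orderedPairs (adj H) ≡ numEdges H + numEdges H
  handshake-graph H = handshake (adj H) (symm H) (irrefl H)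

  degree-sum : ∀ {n} (H : Graph n) → ∑[ i < n ] degree H i ≡ numEdges H + numEdges H
  degree-sum H = trans (sum-cong-≗ (degree-as-sum H)) (handshake-graph H)

  restrict : ∀ {n} → Labelling n → Fin n → (Fin n → Fin n → Bool) → Fin n → Fin n → Bool
  restrict c k r i j = inBlock c k i ∧ inBlock c k j ∧ r i j

  -- The subgraph induced by a block, so that eBlock H c k = numEdges (blockGraph H c k).
  blockGraph : ∀ {n} → Graph n → Labelling n → Fin n → Graph n
  blockGraph H c k = record
    { adj    = restrict c k (adj H)
    ; symm   = λ i j → trans (cong (λ x → inBlock c k i ∧ inBlock c k j ∧ x) (symm H i j))
                             (swap (inBlock c k i) (inBlock c k j) (adj H j i))
    ; irrefl = λ i → trans (cong (λ x → inBlock c k i ∧ inBlock c k i ∧ x) (irrefl H i))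
                           (∧-false (inBlock c k i))
    }
    where
    swap : ∀ a b x → (a ∧ b ∧ x) ≡ (b ∧ a ∧ x)
    swap true  true  x = refl
    swap true  false x = refl
    swap false true  x = refl
    swap false false x = refl
    ∧-false : ∀ a → (a ∧ a ∧ false) ≡ false
    ∧-false true  = refl
    ∧-false false = refl

  one-block : ∀ {n} (t : Fin n) → ∑[ k < n ] 𝟙 ⌊ t ≟ᶠ k ⌋ ≡ 1
  one-block {suc n} zero    = cong suc (sum-replicate-zero n)
  one-block {suc n} (suc t) = trans (sum-cong-≗ (λ k → cong 𝟙 (≟-suc k))) (one-block t)
    where
    ≟-suc : ∀ k → ⌊ suc t ≟ᶠ suc k ⌋ ≡ ⌊ t ≟ᶠ k ⌋
    ≟-suc k with t ≟ᶠ k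
    ... | yes _ = refl
    ... | no  _ = refl

  ∑-blocks : ∀ {n} (c : Labelling n) (i : Fin n) (x : ℕ) →
             ∑[ k < n ] (𝟙 (inBlock c k i) * x) ≡ x
  ∑-blocks {n} c i x = begin
    ∑[ k < n ] (𝟙 (inBlock c k i) * x) ≡⟨ sym (*-distribʳ-sum x (λ k → 𝟙 (inBlock c k i))) ⟩
    ∑[ k < n ] 𝟙 (inBlock c k i) * x  ≡⟨ cong (_* x) (one-block (c i)) ⟩
    1 * x                              ≡⟨ *-identityˡ x ⟩
    x                                  ∎
    where open ≡-Reasoning

  volBlock-sum : ∀ {n} (H : Graph n) (c : Labelling n) →
                 ∑[ k < n ] volBlock H c k ≡ numEdges H + numEdges H
  volBlock-sum {n} H c = begin
    ∑[ k < n ] volBlock H c k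
      ≡⟨ sum-cong-≗ (volBlock-as-sum H c) ⟩
    ∑[ k < n ] ∑[ i < n ] (𝟙 (inBlock c k i) * degree H i)
      ≡⟨ ∑-comm (λ k i → 𝟙 (inBlock c k i) * degree H i) ⟩
    ∑[ i < n ] ∑[ k < n ] (𝟙 (inBlock c k i) * degree H i)
      ≡⟨ sum-cong-≗ (λ i → ∑-blocks c i (degree H i)) ⟩
    ∑[ i < n ] degree H i
      ≡⟨ degree-sum H ⟩
    numEdges H + numEdges H ∎
    where open ≡-Reasoning

  -- The blocks of a labelling are disjoint, so restricting a relation to each
  -- block and adding up cannot produce more pairs than the relation has.
  blocks-edges-≤ : ∀ {n} (c : Labelling n) (r : Fin n → Fin n → Bool) →
                   ∑[ k < n ] edgesWhere (restrict c k r) ≤ edgesWhere r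
  blocks-edges-≤ {n} c r = begin
    ∑[ k < n ] edgesWhere (restrict c k r)
      ≡⟨ sum-cong-≗ (λ k → edgesWhere-as-sum (restrict c k r)) ⟩
    ∑[ k < n ] ∑[ i < n ] ∑[ j < n ] inside k i j
      ≡⟨ ∑-comm (λ k i → ∑[ j < n ] inside k i j) ⟩
    ∑[ i < n ] ∑[ k < n ] ∑[ j < n ] inside k i j
      ≡⟨ sum-cong-≗ (λ i → ∑-comm (λ k j → inside k i j)) ⟩
    ∑[ i < n ] ∑[ j < n ] ∑[ k < n ] inside k i j
      ≤⟨ ∑-mono-≤ (λ i → ∑-mono-≤ (λ j → ∑-mono-≤ (λ k → restricted-≤ (below i j)
                           (inBlock c k i) (inBlock c k j) (r i j)))) ⟩
    ∑[ i < n ] ∑[ j < n ] ∑[ k < n ] (𝟙 (inBlock c k i) * 𝟙 (below i j ∧ r i j))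
      ≡⟨ sum-cong-≗ (λ i → sum-cong-≗ (λ j → ∑-blocks c i (𝟙 (below i j ∧ r i j)))) ⟩
    ∑[ i < n ] ∑[ j < n ] 𝟙 (below i j ∧ r i j)
      ≡⟨ sym (edgesWhere-as-sum r) ⟩
    edgesWhere r ∎
    where
    open ≤-Reasoning
    inside : Fin n → Fin n → Fin n → ℕ
    inside k i j = 𝟙 (below i j ∧ restrict c k r i j)
    restricted-≤ : ∀ p a b x → 𝟙 (p ∧ a ∧ b ∧ x) ≤ 𝟙 a * 𝟙 (p ∧ x)
    restricted-≤ false a     b     x     = z≤n
    restricted-≤ true  false b     x     = z≤n
    restricted-≤ true  true  false x     = z≤n
    restricted-≤ true  true  true  false = z≤n
    restricted-≤ true  true  true  true  = s≤s z≤n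

  𝟙-∧ : ∀ a b → 𝟙 (a ∧ b) ≡ 𝟙 a * 𝟙 b
  𝟙-∧ true  b = sym (+-identityʳ (𝟙 b))
  𝟙-∧ false b = refl

  volBlock-as-pairs : ∀ {n} (H : Graph n) (c : Labelling n) (k : Fin n) →
    volBlock H c k ≡ ∑[ i < n ] ∑[ j < n ] 𝟙 (inBlock c k i ∧ adj H i j)
  volBlock-as-pairs {n} H c k = begin
    volBlock H c k
      ≡⟨ volBlock-as-sum H c k ⟩
    ∑[ i < n ] (𝟙 (χ i) * degree H i)
      ≡⟨ sum-cong-≗ (λ i → cong (𝟙 (χ i) *_) (degree-as-sum H i)) ⟩
    ∑[ i < n ] (𝟙 (χ i) * ∑[ j < n ] 𝟙 (adj H i j))
      ≡⟨ sum-cong-≗ (λ i → *-distribˡ-sum (𝟙 (χ i)) (λ j → 𝟙 (adj H i j))) ⟩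
    ∑[ i < n ] ∑[ j < n ] (𝟙 (χ i) * 𝟙 (adj H i j))
      ≡⟨ sum-cong-≗ (λ i → sum-cong-≗ (λ j → sym (𝟙-∧ (χ i) (adj H i j)))) ⟩
    ∑[ i < n ] ∑[ j < n ] 𝟙 (χ i ∧ adj H i j) ∎
    where
    open ≡-Reasoning
    χ : Fin n → Bool
    χ i = inBlock c k i

  half-≤ : ∀ {x y} → x + x ≤ y + y → x ≤ y
  half-≤ {x} {y} 2x≤2y with ≤-<-connex x y
  ... | inj₁ x≤y = x≤y
  ... | inj₂ y<x = ⊥-elim (<-irrefl refl (<-≤-trans (+-mono-< y<x y<x) 2x≤2y))

  volBlock-as-pairs′ : ∀ {n} (H : Graph n) (c : Labelling n) (k : Fin n) →
    volBlock H c k ≡ ∑[ i < n ] ∑[ j < n ] 𝟙 (inBlock c k j ∧ adj H i j)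
  volBlock-as-pairs′ {n} H c k =
    trans (volBlock-as-pairs H c k)
      (trans (∑-comm (λ i j → 𝟙 (inBlock c k i ∧ adj H i j)))
             (sum-cong-≗ (λ i → sum-cong-≗ (λ j → cong (λ x → 𝟙 (inBlock c k j ∧ x)) (symm H j i)))))

  -- An edge is counted at most twice by vol(A), and twice only when it lies inside A:
  -- 2 vol(A) ≤ 2 e(A) + 2 m, i.e. vol(A) ≤ m + e(A).
  volBlock-≤ : ∀ {n} (H : Graph n) (c : Labelling n) (k : Fin n) →
               volBlock H c k ≤ numEdges H + eBlock H c k
  volBlock-≤ {n} H c k = half-≤ (begin
    volBlock H c k + volBlock H c k
      ≡⟨ cong₂ _+_ (volBlock-as-pairs H c k) (volBlock-as-pairs′ H c k) ⟩
    ∑[ i < n ] ∑[ j < n ] 𝟙 (χ i ∧ a i j) + ∑[ i < n ] ∑[ j < n ] 𝟙 (χ j ∧ a i j)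
      ≡⟨ sym (∑∑-distrib-+ (λ i j → 𝟙 (χ i ∧ a i j)) (λ i j → 𝟙 (χ j ∧ a i j))) ⟩
    ∑[ i < n ] ∑[ j < n ] (𝟙 (χ i ∧ a i j) + 𝟙 (χ j ∧ a i j))
      ≤⟨ ∑-mono-≤ (λ i → ∑-mono-≤ (λ j → inside-or-cut (χ i) (χ j) (a i j))) ⟩
    ∑[ i < n ] ∑[ j < n ] (𝟙 (restrict c k a i j) + 𝟙 (a i j))
      ≡⟨ ∑∑-distrib-+ (λ i j → 𝟙 (restrict c k a i j)) (λ i j → 𝟙 (a i j)) ⟩
    orderedPairs (restrict c k a) + orderedPairs a
      ≡⟨ cong₂ _+_ (handshake-graph (blockGraph H c k)) (handshake-graph H) ⟩
    (eBlock H c k + eBlock H c k) + (numEdges H + numEdges H)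
      ≡⟨ regroup (eBlock H c k) (numEdges H) ⟩
    (numEdges H + eBlock H c k) + (numEdges H + eBlock H c k) ∎)
    where
    open ≤-Reasoning
    χ : Fin n → Bool
    χ i = inBlock c k i
    a : Fin n → Fin n → Bool
    a = adj H
    inside-or-cut : ∀ p q x → 𝟙 (p ∧ x) + 𝟙 (q ∧ x) ≤ 𝟙 (p ∧ q ∧ x) + 𝟙 x
    inside-or-cut true  true  true  = s≤s (s≤s z≤n)
    inside-or-cut true  false true  = s≤s z≤n
    inside-or-cut false true  true  = s≤s z≤n
    inside-or-cut false false true  = z≤n
    inside-or-cut true  true  false = z≤n
    inside-or-cut true  false false = z≤n
    inside-or-cut false true  false = z≤n
    inside-or-cut false false false = z≤n
    regroup : ∀ e m → (e + e) + (m + m) ≡ (m + e) + (m + e)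
    regroup = solve-∀

module EdgeSplitting where
  open FiniteSums
  open Counting
  open Blocks using (restrict; volBlock-as-pairs)
  open import Data.Nat using (_+_)
  open import Data.Bool using (Bool; true; false; _∧_; not)
  open import Data.Fin using (Fin)
  open import Data.Empty using (⊥-elim)
  open import Relation.Binary.PropositionalEquality
    using (_≡_; _≢_; refl; sym; cong₂; trans)

  Splits : ∀ {n} (r r₁ r₂ : Fin n → Fin n → Bool) → Set
  Splits r r₁ r₂ = ∀ i j → 𝟙 (r i j) ≡ 𝟙 (r₁ i j) + 𝟙 (r₂ i j)

  ∧-split : ∀ p {x y z} → 𝟙 x ≡ 𝟙 y + 𝟙 z → 𝟙 (p ∧ x) ≡ 𝟙 (p ∧ y) + 𝟙 (p ∧ z)
  ∧-split true  h = h
  ∧-split false h = refl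

  ∑∑-split : ∀ {n} {r r₁ r₂ : Fin n → Fin n → Bool} (p : Fin n → Fin n → Bool) →
    Splits r r₁ r₂ →
    ∑[ i < n ] ∑[ j < n ] 𝟙 (p i j ∧ r i j)
      ≡ ∑[ i < n ] ∑[ j < n ] 𝟙 (p i j ∧ r₁ i j) + ∑[ i < n ] ∑[ j < n ] 𝟙 (p i j ∧ r₂ i j)
  ∑∑-split {n} {r} {r₁} {r₂} p h =
    trans (sum-cong-≗ (λ i → sum-cong-≗ (λ j → ∧-split (p i j) (h i j))))
          (∑∑-distrib-+ (λ i j → 𝟙 (p i j ∧ r₁ i j)) (λ i j → 𝟙 (p i j ∧ r₂ i j)))

  splits-edgesWhere : ∀ {n} {r r₁ r₂ : Fin n → Fin n → Bool} → Splits r r₁ r₂ →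
    edgesWhere r ≡ edgesWhere r₁ + edgesWhere r₂
  splits-edgesWhere {r = r} {r₁} {r₂} h =
    trans (edgesWhere-as-sum r)
          (trans (∑∑-split below h) (sym (cong₂ _+_ (edgesWhere-as-sum r₁) (edgesWhere-as-sum r₂))))

  splits-restrict : ∀ {n} {r r₁ r₂ : Fin n → Fin n → Bool} (c : Labelling n) (k : Fin n) →
    Splits r r₁ r₂ → Splits (restrict c k r) (restrict c k r₁) (restrict c k r₂)
  splits-restrict c k h i j = ∧-split (inBlock c k i) (∧-split (inBlock c k j) (h i j))

  splits-eBlock : ∀ {n} {G H₁ H₂ : Graph n} → Splits (adj G) (adj H₁) (adj H₂) →
    ∀ c k → eBlock G c k ≡ eBlock H₁ c k + eBlock H₂ c k
  splits-eBlock h c k = splits-edgesWhere (splits-restrict c k h)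

  splits-volBlock : ∀ {n} {G H₁ H₂ : Graph n} → Splits (adj G) (adj H₁) (adj H₂) →
    ∀ c k → volBlock G c k ≡ volBlock H₁ c k + volBlock H₂ c k
  splits-volBlock {G = G} {H₁} {H₂} h c k =
    trans (volBlock-as-pairs G c k)
          (trans (∑∑-split (λ i j → inBlock c k i) h)
                 (sym (cong₂ _+_ (volBlock-as-pairs H₁ c k) (volBlock-as-pairs H₂ c k))))

  edgeGraph : ∀ {n} {G : Graph n} → EdgeSubset G → Graph n
  edgeGraph {G = G} E₀ = record
    { adj    = sel E₀
    ; symm   = EdgeSubset.symm E₀
    ; irrefl = λ i → not-loop i (sel E₀ i i) refl
    }
    where
    not-loop : ∀ i b → sel E₀ i i ≡ b → b ≡ false
    not-loop i true  e = ⊥-elim (true≢false (trans (sym (sub E₀ i i e)) (irrefl G i)))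
      where
      true≢false : true ≢ false
      true≢false ()
    not-loop i false e = refl

  deleteEdges-splits : ∀ {n} (G : Graph n) (E₀ : EdgeSubset G) →
    Splits (adj G) (adj (deleteEdges G E₀)) (sel E₀)
  deleteEdges-splits G E₀ i j = split (adj G i j) (sel E₀ i j) (sub E₀ i j)
    where
    split : ∀ a s → (s ≡ true → a ≡ true) → 𝟙 a ≡ 𝟙 (a ∧ not s) + 𝟙 s
    split a     true  s⊆a rewrite s⊆a refl = refl
    split true  false s⊆a = refl
    split false false s⊆a = refl

module NatInequalities where
  open FiniteSums
  open import Data.Nat using (ℕ; suc; _+_; _*_; _∸_; _≤_; _<_)
  open import Data.Nat.Properties
    using (≤-<-connex; m+[n∸m]≡n; <⇒≤; m≤m+n; m≤n+m; +-monoʳ-≤; +-mono-≤; *-mono-≤;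
           *-monoʳ-≤; +-comm; ≤-trans; +-cancelʳ-≤; module ≤-Reasoning)
  open import Data.Fin using (Fin)
  open import Data.Sum using (inj₁; inj₂)
  open import Relation.Binary.PropositionalEquality using (_≡_; sym; subst; subst₂; cong₂)
  open import Data.Nat.Tactic.RingSolver using (solve-∀)

  -- Arithmetic–geometric mean inequality 2xy ≤ x² + y², first for x ≤ y, writing y = x + t.
  two-products-≤-ordered : ∀ {x y} → x ≤ y → 2 * x * y ≤ x * x + y * y
  two-products-≤-ordered {x} {y} x≤y =
    subst (λ z → 2 * x * z ≤ x * x + z * z) (m+[n∸m]≡n x≤y) (near x (y ∸ x))
    where
    expand : ∀ x t → 2 * x * (x + t) + t * t ≡ x * x + (x + t) * (x + t)
    expand = solve-∀
    near : ∀ x t → 2 * x * (x + t) ≤ x * x + (x + t) * (x + t)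
    near x t = subst (2 * x * (x + t) ≤_) (expand x t) (m≤m+n _ (t * t))

  two-products-≤ : ∀ x y → 2 * x * y ≤ x * x + y * y
  two-products-≤ x y with ≤-<-connex x y
  ... | inj₁ x≤y = two-products-≤-ordered x≤y
  ... | inj₂ y<x = subst₂ _≤_ (swap y x) (+-comm (y * y) (x * x)) (two-products-≤-ordered (<⇒≤ y<x))
    where
    swap : ∀ y x → 2 * y * x ≡ 2 * x * y
    swap = solve-∀

  weighted-square-≤ : ∀ P K a w →
    P * K * ((a + w) * (a + w)) ≤ (P + K) * K * (a * a) + (P + K) * P * (w * w)
  weighted-square-≤ P K a w =
    subst₂ _≤_ (lhs P K a w) (rhs P K a w)
      (+-monoʳ-≤ (P * K * (a * a) + P * K * (w * w)) (two-products-≤ (K * a) (P * w)))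
    where
    lhs : ∀ P K a w → P * K * (a * a) + P * K * (w * w) + 2 * (K * a) * (P * w)
                      ≡ P * K * ((a + w) * (a + w))
    lhs = solve-∀
    rhs : ∀ P K a w → P * K * (a * a) + P * K * (w * w) + (K * a * (K * a) + P * w * (P * w))
                      ≡ (P + K) * K * (a * a) + (P + K) * P * (w * w)
    rhs = solve-∀

  ∑-weighted-squares-≤ : ∀ {n} P K (a w : Fin n → ℕ) →
    P * K * ∑[ i < n ] ((a i + w i) * (a i + w i))
      ≤ (P + K) * K * ∑[ i < n ] (a i * a i) + (P + K) * P * (∑[ i < n ] w i * ∑[ i < n ] w i)
  ∑-weighted-squares-≤ {n} P K a w = begin
    P * K * ∑[ i < n ] ((a i + w i) * (a i + w i))
      ≡⟨ *-distribˡ-sum (P * K) (λ i → (a i + w i) * (a i + w i)) ⟩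
    ∑[ i < n ] (P * K * ((a i + w i) * (a i + w i)))
      ≤⟨ ∑-mono-≤ (λ i → weighted-square-≤ P K (a i) (w i)) ⟩
    ∑[ i < n ] ((P + K) * K * (a i * a i) + (P + K) * P * (w i * w i))
      ≡⟨ ∑-distrib-+ (λ i → (P + K) * K * (a i * a i)) (λ i → (P + K) * P * (w i * w i)) ⟩
    ∑[ i < n ] ((P + K) * K * (a i * a i)) + ∑[ i < n ] ((P + K) * P * (w i * w i))
      ≡⟨ cong₂ _+_ (sym (*-distribˡ-sum ((P + K) * K) (λ i → a i * a i)))
                   (sym (*-distribˡ-sum ((P + K) * P) (λ i → w i * w i))) ⟩
    (P + K) * K * ∑[ i < n ] (a i * a i) + (P + K) * P * ∑[ i < n ] (w i * w i)
      ≤⟨ +-monoʳ-≤ ((P + K) * K * ∑[ i < n ] (a i * a i)) (*-monoʳ-≤ ((P + K) * P) (∑-squares-≤ w)) ⟩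
    (P + K) * K * ∑[ i < n ] (a i * a i) + (P + K) * P * (∑[ i < n ] w i * ∑[ i < n ] w i) ∎
    where open ≤-Reasoning

  <-by-slack : ∀ L R X Y Z → R + Y ≡ L + X + Z → Y ≤ X → 1 ≤ Z → L < R
  <-by-slack L R X Y Z identity Y≤X 1≤Z = +-cancelʳ-≤ Y (suc L) R (begin
    suc L + Y      ≡⟨ regroup L Y ⟩
    L + Y + 1      ≤⟨ +-mono-≤ (+-monoʳ-≤ L Y≤X) 1≤Z ⟩
    L + X + Z      ≡⟨ sym identity ⟩
    R + Y          ∎)
    where
    open ≤-Reasoning
    regroup : ∀ L Y → suc L + Y ≡ L + Y + 1
    regroup = solve-∀

  -- The two numerator inequalities behind the comparison of modularities (see
  -- Modularity.values-close).  Here P = e(G'), K = |E₀|, M = P + K, x = Σ e'(A),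
  -- d = Σ e₀(A), S = Σ vol(A)², S' = Σ vol'(A)², all over the blocks A of a partition.
  module Numerators (P K x d S S' : ℕ) where
    M : ℕ
    M = P + K

    -- q(G) < q(G') + 2K/M, multiplied out by the common denominator 4 M² P².
    upper-numerator : 1 ≤ K → 1 ≤ S' → S' ≤ S → d ≤ K → S' ≤ (P + x) * (P + P) →
      (x + d) * (4 * M * P * P) + S' * (M * M) < x * (4 * M * M * P) + 2 * K * (4 * M * P * P) + S * (P * P)
    upper-numerator 1≤K 1≤S' S'≤S d≤K S'≤ =
      <-by-slack _ _ (P * P * S + 4 * M * P * P * K + 2 * K * M * ((P + x) * (P + P)))
                     (P * P * S' + 4 * M * P * P * d + 2 * K * M * S') (K * K * S')
        (identity P K x d S S')
        (+-mono-≤ (+-mono-≤ (*-monoʳ-≤ (P * P) S'≤S) (*-monoʳ-≤ (4 * M * P * P) d≤K))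
                  (*-monoʳ-≤ (2 * K * M) S'≤))
        (*-mono-≤ (*-mono-≤ 1≤K 1≤K) 1≤S')
      where
      identity : ∀ P K x d S S' →
        x * (4 * (P + K) * (P + K) * P) + 2 * K * (4 * (P + K) * P * P) + S * (P * P)
          + (P * P * S' + 4 * (P + K) * P * P * d + 2 * K * (P + K) * S')
        ≡ (x + d) * (4 * (P + K) * P * P) + S' * ((P + K) * (P + K))
          + (P * P * S + 4 * (P + K) * P * P * K + 2 * K * (P + K) * ((P + x) * (P + P)))
          + K * K * S'
      identity = solve-∀

    -- q(G') < q(G) + 2K/M, multiplied out by the same denominator.
    lower-numerator : 1 ≤ K → 1 ≤ S' → P * S ≤ M * S' + 4 * M * P * K → x ≤ P →
      x * (4 * M * M * P) + S * (P * P) < (x + d) * (4 * M * P * P) + 2 * K * (4 * M * P * P) + S' * (M * M)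
    lower-numerator 1≤K 1≤S' PS≤ x≤P =
      <-by-slack _ _ (P * (M * S' + 4 * M * P * K) + 4 * M * P * K * P)
                     (P * (P * S) + 4 * M * P * K * x) (M * K * S' + 4 * M * P * P * d)
        (identity P K x d S S')
        (+-mono-≤ (*-monoʳ-≤ P PS≤) (*-monoʳ-≤ (4 * M * P * K) x≤P))
        (≤-trans (*-mono-≤ (*-mono-≤ (≤-trans 1≤K (m≤n+m K P)) 1≤K) 1≤S') (m≤m+n _ _))
      where
      identity : ∀ P K x d S S' →
        (x + d) * (4 * (P + K) * P * P) + 2 * K * (4 * (P + K) * P * P) + S' * ((P + K) * (P + K))
          + (P * (P * S) + 4 * (P + K) * P * K * x)
        ≡ x * (4 * (P + K) * (P + K) * P) + S * (P * P)
          + (P * ((P + K) * S' + 4 * (P + K) * P * K) + 4 * (P + K) * P * K * P)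
          + ((P + K) * K * S' + 4 * (P + K) * P * P * d)
      identity = solve-∀

module Fractions where
  open import Data.Nat as ℕ using (suc; NonZero)
  import Data.Nat.Properties as ℕ
  import Data.Integer as ℤ
  import Data.Integer.Properties as ℤ
  open import Data.Integer using (+_)
  open import Data.Rational using (_+_; _-_; -_; _<_; 0ℚ; toℚᵘ)
  import Data.Rational.Properties as ℚ
  import Data.Rational.Unnormalised as ℚᵘ
  import Data.Rational.Unnormalised.Properties as ℚᵘ
  open import Data.Rational.Solver using (module +-*-Solver)
  open import Relation.Binary.PropositionalEquality using (_≡_; refl; sym; trans; cong; subst₂)
  import Data.Integer.Tactic.RingSolver as ℤ-Solver
  import Data.Nat.Tactic.RingSolver as ℕ-Solver
  open +-*-Solver

  ÷-unnormalised : ∀ a d → toℚᵘ (a ÷ suc d) ℚᵘ.≃ ℚᵘ.mkℚᵘ (+ a) d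
  ÷-unnormalised a d = ℚ.toℚᵘ-fromℚᵘ (ℚᵘ.mkℚᵘ (+ a) d)

  ÷-cross : ∀ a b p q .{{_ : NonZero p}} .{{_ : NonZero q}} →
            a ℕ.* q ≡ b ℕ.* p → a ÷ p ≡ b ÷ q
  ÷-cross a b (suc p) (suc q) aq≡bp = ℚ.toℚᵘ-injective
    (ℚᵘ.≃-trans (÷-unnormalised a p)
      (ℚᵘ.≃-trans (ℚᵘ.*≡* cross) (ℚᵘ.≃-sym (÷-unnormalised b q))))
    where
    cross : + a ℤ.* + suc q ≡ + b ℤ.* + suc p
    cross = trans (sym (ℤ.pos-* a (suc q))) (trans (cong +_ aq≡bp) (ℤ.pos-* b (suc p)))

  ÷-cross-< : ∀ a b p q .{{_ : NonZero p}} .{{_ : NonZero q}} →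
              a ℕ.* q ℕ.< b ℕ.* p → a ÷ p < b ÷ q
  ÷-cross-< a b (suc p) (suc q) aq<bp = ℚ.toℚᵘ-cancel-<
    (ℚᵘ.<-respˡ-≃ (ℚᵘ.≃-sym (÷-unnormalised a p))
      (ℚᵘ.<-respʳ-≃ (ℚᵘ.≃-sym (÷-unnormalised b q))
        (ℚᵘ.*<* (subst₂ ℤ._<_ (ℤ.pos-* a (suc q)) (ℤ.pos-* b (suc p)) (ℤ.+<+ aq<bp)))))

  ÷-+ : ∀ a b p .{{_ : NonZero p}} → a ÷ p + b ÷ p ≡ (a ℕ.+ b) ÷ p
  ÷-+ a b (suc p) = ℚ.toℚᵘ-injective
    (ℚᵘ.≃-trans (ℚ.toℚᵘ-homo-+ (a ÷ suc p) (b ÷ suc p))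
      (ℚᵘ.≃-trans (ℚᵘ.+-cong (÷-unnormalised a p) (÷-unnormalised b p))
        (ℚᵘ.≃-trans (ℚᵘ.*≡* cross) (ℚᵘ.≃-sym (÷-unnormalised (a ℕ.+ b) p)))))
    where
    D : ℤ.ℤ
    D = + suc p
    distribute : ∀ A B D → (A ℤ.* D ℤ.+ B ℤ.* D) ℤ.* D ≡ (A ℤ.+ B) ℤ.* (D ℤ.* D)
    distribute = ℤ-Solver.solve-∀
    cross : (+ a ℤ.* D ℤ.+ + b ℤ.* D) ℤ.* D ≡ + (a ℕ.+ b) ℤ.* (D ℤ.* D)
    cross = trans (distribute (+ a) (+ b) D) (cong (ℤ._* (D ℤ.* D)) (sym (ℤ.pos-+ a b)))

  ÷-expand : ∀ a p t D .{{_ : NonZero p}} .{{_ : NonZero D}} → p ℕ.* t ≡ D → a ÷ p ≡ (a ℕ.* t) ÷ D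
  ÷-expand a p t D pt≡D =
    ÷-cross a (a ℕ.* t) p D (trans (cong (a ℕ.*_) (sym pt≡D)) (reassociate a p t))
    where
    reassociate : ∀ a p t → a ℕ.* (p ℕ.* t) ≡ a ℕ.* t ℕ.* p
    reassociate = ℕ-Solver.solve-∀

  0÷ : ∀ p .{{_ : NonZero p}} → 0 ÷ p ≡ 0ℚ
  0÷ p = ÷-cross 0 0 p 1 refl

  ÷-compare : ∀ D .{{_ : NonZero D}} a b e f g → a ℕ.+ f ℕ.< e ℕ.+ g ℕ.+ b →
              a ÷ D - b ÷ D < (e ÷ D - f ÷ D) + g ÷ D
  ÷-compare D a b e f g a+f<e+g+b =
    subst₂ _<_ (cancel (a ÷ D) (f ÷ D) (b ÷ D)) (rearrange (e ÷ D) (g ÷ D) (b ÷ D) (f ÷ D))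
      (ℚ.+-monoˡ-< (- (f ÷ D) - b ÷ D) sums<)
    where
    sums< : a ÷ D + f ÷ D < e ÷ D + g ÷ D + b ÷ D
    sums< = subst₂ _<_ (sym (÷-+ a f D))
                       (sym (trans (cong (_+ b ÷ D) (÷-+ e g D)) (÷-+ (e ℕ.+ g) b D)))
                       (÷-cross-< (a ℕ.+ f) (e ℕ.+ g ℕ.+ b) D D (ℕ.*-monoˡ-< D a+f<e+g+b))
    cancel : ∀ A F B → (A + F) + (- F - B) ≡ A - B
    cancel = solve 3 (λ A F B → (A :+ F) :+ (:- F :- B) := A :- B) refl
    rearrange : ∀ E G B F → (E + G + B) + (- F - B) ≡ (E - F) + G
    rearrange = solve 4 (λ E G B F → (E :+ G :+ B) :+ (:- F :- B) := (E :- F) :+ G) refl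

module Maxima where
  open import Data.Rational using (ℚ; _+_; _-_; -_; _<_; _⊔_; ∣_∣)
  import Data.Rational.Properties as ℚ
  open import Data.Rational.Solver using (module +-*-Solver)
  open import Data.List using (List; []; _∷_; map; foldr)
  open import Data.Sum using (inj₁; inj₂; [_,_]′)
  open import Relation.Binary.PropositionalEquality using (_≡_; refl; sym; trans; cong₂; subst)
  open +-*-Solver

  maxOver : ∀ {A : Set} → (A → ℚ) → A → List A → ℚ
  maxOver f x₀ xs = foldr _⊔_ (f x₀) (map f xs)

  ⊔-<-lub : ∀ {p q r} → p < r → q < r → p ⊔ q < r
  ⊔-<-lub {p} {q} p<r q<r =
    [ (λ p⊔q≡p → subst (_< _) (sym p⊔q≡p) p<r) , (λ p⊔q≡q → subst (_< _) (sym p⊔q≡q) q<r) ]′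
      (ℚ.⊔-sel p q)

  maxOver-< : ∀ {A : Set} (f g : A → ℚ) (ε : ℚ) (x₀ : A) (xs : List A) →
              (∀ x → f x < g x + ε) → maxOver f x₀ xs < maxOver g x₀ xs + ε
  maxOver-< f g ε x₀ []       f<g+ε = f<g+ε x₀
  maxOver-< f g ε x₀ (x ∷ xs) f<g+ε = ⊔-<-lub
    (ℚ.<-≤-trans (f<g+ε x) (ℚ.+-monoˡ-≤ ε (ℚ.p≤p⊔q (g x) (maxOver g x₀ xs))))
    (ℚ.<-≤-trans (maxOver-< f g ε x₀ xs f<g+ε) (ℚ.+-monoˡ-≤ ε (ℚ.p≤q⊔p (g x) (maxOver g x₀ xs))))

  maxOver-const : ∀ {A : Set} (f : A → ℚ) (c : ℚ) (x₀ : A) (xs : List A) →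
                  (∀ x → f x ≡ c) → maxOver f x₀ xs ≡ c
  maxOver-const f c x₀ []       f≡c = f≡c x₀
  maxOver-const f c x₀ (x ∷ xs) f≡c =
    trans (cong₂ _⊔_ (f≡c x) (maxOver-const f c x₀ xs f≡c)) (ℚ.⊔-idem c)

  <-shift : ∀ u v ε → u < v + ε → u - v < ε
  <-shift u v ε u<v+ε = subst (u - v <_) (cancel v ε) (ℚ.+-monoˡ-< (- v) u<v+ε)
    where
    cancel : ∀ v ε → (v + ε) - v ≡ ε
    cancel = solve 2 (λ v ε → (v :+ ε) :- v := ε) refl

  ∣-∣-< : ∀ {u v ε} → u < v + ε → v < u + ε → ∣ u - v ∣ < ε
  ∣-∣-< {u} {v} {ε} u<v+ε v<u+ε with ℚ.∣p∣≡p∨∣p∣≡-p (u - v)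
  ... | inj₁ ∣u-v∣≡u-v = subst (_< ε) (sym ∣u-v∣≡u-v) (<-shift u v ε u<v+ε)
  ... | inj₂ ∣u-v∣≡-[u-v] =
    subst (_< ε) (sym (trans ∣u-v∣≡-[u-v] (negate u v))) (<-shift v u ε v<u+ε)
    where
    negate : ∀ u v → - (u - v) ≡ v - u
    negate = solve 2 (λ u v → :- (u :- v) := v :- u) refl

module Modularity where
  open FiniteSums
  open Counting using (listSum-allFin)
  open NatInequalities
  open Fractions
  open Maxima
  open import Data.Nat as ℕ using (ℕ; zero; suc; _+_; _*_; _≤_; NonZero; z≤n; s≤s)
  import Data.Nat.Properties as ℕ
  open import Data.Rational using (ℚ; _-_; _<_; 0ℚ)
  import Data.Rational as ℚ
  open import Data.Product using (_×_; _,_)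
  open import Relation.Binary.PropositionalEquality using (_≡_; refl; sym; trans; cong; cong₂; subst₂)
  open import Function using (id)
  open import Data.Nat.Tactic.RingSolver using (solve-∀)

  -- The modularity formula e/m − s/(4m²), for total edge weight e inside blocks
  -- and sum of squared volumes s, in a graph with m edges (0 when m = 0).
  modularityValue : ℕ → ℕ → ℕ → ℚ
  modularityValue m e s = e ÷ m - s ÷ (4 * m * m)

  modularity-as-value : ∀ {n} (H : Graph n) (c : Labelling n) →
    modularity H c ≡ modularityValue (numEdges H)
                       (∑[ k < n ] eBlock H c k) (∑[ k < n ] (volBlock H c k * volBlock H c k))
  modularity-as-value {n} H c =
    cong₂ (λ e s → e ÷ numEdges H - s ÷ (4 * numEdges H * numEdges H))
          (listSum-allFin (eBlock H c)) (listSum-allFin (λ k → volBlock H c k * volBlock H c k))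

  modularity-edgeless : ∀ {n} (H : Graph n) → numEdges H ≡ 0 → ∀ c → modularity H c ≡ 0ℚ
  modularity-edgeless {n} H m≡0 c =
    trans (modularity-as-value H c)
          (cong (λ m → modularityValue m (∑[ k < n ] eBlock H c k)
                                         (∑[ k < n ] (volBlock H c k * volBlock H c k))) m≡0)

  maxModularity-as-max : ∀ {n} (H : Graph n) →
    maxModularity H ≡ maxOver (modularity H) id (allFuns n n)
  maxModularity-as-max {n} H = trans unfold (by-edge-count (numEdges H) refl)
    where
    byEdgeCount : ℕ → ℚ
    byEdgeCount zero    = 0ℚ
    byEdgeCount (suc _) = maxOver (modularity H) id (allFuns n n)
    unfold : maxModularity H ≡ byEdgeCount (numEdges H)
    unfold with numEdges H
    ... | zero  = refl
    ... | suc _ = refl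
    by-edge-count : ∀ m → numEdges H ≡ m → byEdgeCount m ≡ maxOver (modularity H) id (allFuns n n)
    by-edge-count zero    m≡0 =
      sym (maxOver-const (modularity H) 0ℚ id (allFuns n n) (modularity-edgeless H m≡0))
    by-edge-count (suc _) _   = refl

  Close : ℚ → ℚ → ℚ → Set
  Close u v ε = (u < v ℚ.+ ε) × (v < u ℚ.+ ε)

  value-over : ∀ m e s t u D .{{_ : NonZero m}} .{{_ : NonZero D}} →
    m * t ≡ D → 4 * m * m * u ≡ D → modularityValue m e s ≡ (e * t) ÷ D - (s * u) ÷ D
  value-over (suc m) e s t u D mt≡D mmu≡D =
    cong₂ _-_ (÷-expand e (suc m) t D mt≡D) (÷-expand s (4 * suc m * suc m) u D mmu≡D)

  -- The facts about one labelling that the comparison of modularities needs, for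
  -- P = e(G'), K = |E₀|, x = Σ e'(A), d = Σ e₀(A), S = Σ vol(A)², S' = Σ vol'(A)².
  record Bounds (P K x d S S' : ℕ) : Set where
    field
      K-pos : 1 ≤ K
      d≤K   : d ≤ K
      x≤P   : x ≤ P
      S'≤S  : S' ≤ S
      S'≤   : S' ≤ (P + x) * (P + P)
      2P≤S' : P + P ≤ S'
      PS≤   : P * S ≤ (P + K) * S' + 4 * (P + K) * P * K
      S≤    : S ≤ (P + K + (P + K)) * (P + K + (P + K))

  -- The common denominator D = 4 M² P² of q(G), q(G') and the margin 2K/M,
  -- for P = a + 1 edges in G' and K = b + 1 deleted edges.
  module CommonDenominator (a b : ℕ) where
    P K M D : ℕ
    P = suc a
    K = suc b
    M = P + K
    D = 4 * M * M * P * P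

    numG sqG numG' sqG' : ℕ → ℕ
    numG  e  = e * (4 * M * P * P)
    sqG   S  = S * (P * P)
    numG' x  = x * (4 * M * M * P)
    sqG'  S' = S' * (M * M)

    numε : ℕ
    numε = 2 * K * (4 * M * P * P)

    private
      den₁ : ∀ P K → (P + K) * (4 * (P + K) * P * P) ≡ 4 * (P + K) * (P + K) * P * P
      den₁ = solve-∀
      den₂ : ∀ P K → 4 * (P + K) * (P + K) * (P * P) ≡ 4 * (P + K) * (P + K) * P * P
      den₂ = solve-∀
      den₃ : ∀ P K → P * (4 * (P + K) * (P + K) * P) ≡ 4 * (P + K) * (P + K) * P * P
      den₃ = solve-∀
      den₄ : ∀ P K → 4 * P * P * ((P + K) * (P + K)) ≡ 4 * (P + K) * (P + K) * P * P
      den₄ = solve-∀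

    valueG-over : ∀ e S → modularityValue M e S ≡ numG e ÷ D - sqG S ÷ D
    valueG-over e S = value-over M e S _ _ D (den₁ P K) (den₂ P K)

    valueG'-over : ∀ x S' → modularityValue P x S' ≡ numG' x ÷ D - sqG' S' ÷ D
    valueG'-over x S' = value-over P x S' _ _ D (den₃ P K) (den₄ P K)

    margin-over : (2 * K) ÷ M ≡ numε ÷ D
    margin-over = ÷-expand (2 * K) M _ D (den₁ P K)

  values-close-positive : ∀ a b x d S S' → let P = suc a; K = suc b; M = P + K in
    Bounds P K x d S S' →
    Close (modularityValue M (x + d) S) (modularityValue P x S') ((2 * K) ÷ M)
  values-close-positive a b x d S S' bounds =
    subst₂ _<_ (sym (valueG-over (x + d) S)) (sym (cong₂ ℚ._+_ (valueG'-over x S') margin-over))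
      (÷-compare D (numG (x + d)) (sqG S) (numG' x) (sqG' S') numε
        (upper-numerator K-pos 1≤S' S'≤S d≤K S'≤)) ,
    subst₂ _<_ (sym (valueG'-over x S')) (sym (cong₂ ℚ._+_ (valueG-over (x + d) S) margin-over))
      (÷-compare D (numG' x) (sqG' S') (numG (x + d)) (sqG S) numε
        (lower-numerator K-pos 1≤S' PS≤ x≤P))
    where
    open Bounds bounds
    open CommonDenominator a b
    open Numerators P K x d S S' hiding (M)
    1≤S' : 1 ≤ S'
    1≤S' = ℕ.≤-trans (s≤s z≤n) 2P≤S'

  -- When G' has no edges, q(G') = 0 and |q(G)| < 2 = 2K/K.
  values-close-edgeless : ∀ b e S → let K = suc b in
    e ≤ K → S ≤ (K + K) * (K + K) →
    Close (modularityValue K e S) 0ℚ ((2 * K) ÷ K)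
  values-close-edgeless b e S e≤K S≤ =
    subst₂ _<_ (sym valueG) (sym (cong₂ ℚ._+_ zero-over margin))
      (÷-compare D (e * (4 * K)) (S * 1) 0 0 numε
        (<-by-slack _ _ (4 * K * K) (4 * K * e) (4 * K * K + S) (upper-identity K e S)
          (ℕ.*-monoʳ-≤ (4 * K) e≤K) (ℕ.≤-trans (s≤s z≤n) (ℕ.m≤m+n (4 * K * K) S)))) ,
    subst₂ _<_ (sym zero-over) (sym (cong₂ ℚ._+_ valueG margin))
      (÷-compare D 0 0 (e * (4 * K)) (S * 1) numε
        (<-by-slack _ _ ((K + K) * (K + K)) S (e * (4 * K) + 4 * K * K) (lower-identity K e S)
          S≤ (ℕ.≤-trans (s≤s z≤n) (ℕ.m≤n+m (4 * K * K) (e * (4 * K))))))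
    where
    K D numε : ℕ
    K    = suc b
    D    = 4 * K * K
    numε = 2 * K * (4 * K)
    den : ∀ K → K * (4 * K) ≡ 4 * K * K
    den = solve-∀
    valueG : modularityValue K e S ≡ (e * (4 * K)) ÷ D - (S * 1) ÷ D
    valueG = value-over K e S (4 * K) 1 D (den K) (ℕ.*-identityʳ D)
    zero-over : 0ℚ ≡ 0 ÷ D - 0 ÷ D
    zero-over = sym (cong₂ _-_ (0÷ D) (0÷ D))
    margin : (2 * K) ÷ K ≡ numε ÷ D
    margin = ÷-expand (2 * K) K (4 * K) D (den K)
    upper-identity : ∀ K e S → 0 + 2 * K * (4 * K) + S * 1 + 4 * K * e
                               ≡ e * (4 * K) + 0 + 4 * K * K + (4 * K * K + S)
    upper-identity = solve-∀
    lower-identity : ∀ K e S → e * (4 * K) + 2 * K * (4 * K) + 0 + S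
                               ≡ 0 + S * 1 + (K + K) * (K + K) + (e * (4 * K) + 4 * K * K)
    lower-identity = solve-∀

  values-close : ∀ P K x d S S' → Bounds P K x d S S' →
    Close (modularityValue (P + K) (x + d) S) (modularityValue P x S') ((2 * K) ÷ (P + K))
  values-close P zero x d S S' bounds with Bounds.K-pos bounds
  ... | ()
  values-close zero (suc b) zero d S S' bounds =
    values-close-edgeless b d S (Bounds.d≤K bounds) (Bounds.S≤ bounds)
  values-close zero (suc b) (suc x) d S S' bounds with Bounds.x≤P bounds
  ... | ()
  values-close (suc a) (suc b) x d S S' bounds = values-close-positive a b x d S S' bounds

module BlockSums {n} (H : Graph n) (c : Labelling n) where
  open FiniteSums
  open Blocks
  open import Data.Nat using (ℕ; zero; suc; _+_; _*_; _≤_; z≤n)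
  open import Data.Nat.Properties
    using (≤-trans; ≤-reflexive; +-monoʳ-≤; *-monoˡ-≤; m≤m*n; module ≤-Reasoning)
  open import Relation.Binary.PropositionalEquality using (sym; cong)

  m : ℕ
  m = numEdges H

  edgesInside : ℕ
  edgesInside = ∑[ k < n ] eBlock H c k

  squaredVolumes : ℕ
  squaredVolumes = ∑[ k < n ] (volBlock H c k * volBlock H c k)

  edgesInside-≤ : edgesInside ≤ m
  edgesInside-≤ = blocks-edges-≤ c (adj H)

  -- Since vol(A) ≤ m + e(A) ≤ m + Σ e, we get Σ vol² ≤ (m + Σ e) Σ vol = (m + Σ e) 2m.
  squaredVolumes-≤ : squaredVolumes ≤ (m + edgesInside) * (m + m)
  squaredVolumes-≤ = begin
    ∑[ k < n ] (volBlock H c k * volBlock H c k)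
      ≤⟨ ∑-mono-≤ (λ k → *-monoˡ-≤ (volBlock H c k)
                            (≤-trans (volBlock-≤ H c k) (+-monoʳ-≤ m (∑-term-≤ (eBlock H c) k)))) ⟩
    ∑[ k < n ] ((m + edgesInside) * volBlock H c k)
      ≡⟨ sym (*-distribˡ-sum (m + edgesInside) (volBlock H c)) ⟩
    (m + edgesInside) * ∑[ k < n ] volBlock H c k
      ≡⟨ cong ((m + edgesInside) *_) (volBlock-sum H c) ⟩
    (m + edgesInside) * (m + m) ∎
    where open ≤-Reasoning

  -- Each volume is at most its square, so 2m = Σ vol ≤ Σ vol².
  squaredVolumes-≥ : m + m ≤ squaredVolumes
  squaredVolumes-≥ = begin
    m + m                         ≡⟨ sym (volBlock-sum H c) ⟩
    ∑[ k < n ] volBlock H c k     ≤⟨ ∑-mono-≤ (λ k → ≤-square (volBlock H c k)) ⟩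
    squaredVolumes                ∎
    where
    open ≤-Reasoning
    ≤-square : ∀ v → v ≤ v * v
    ≤-square zero    = z≤n
    ≤-square (suc v) = m≤m*n (suc v) (suc v)

  squaredVolumes-≤-total : squaredVolumes ≤ (m + m) * (m + m)
  squaredVolumes-≤-total =
    ≤-trans (∑-squares-≤ (volBlock H c)) (≤-reflexive (cong (λ v → v * v) (volBlock-sum H c)))

module Deletion {n} (G : Graph n) (E₀ : EdgeSubset G) where
  open FiniteSums
  open Counting using (𝟙)
  open Blocks using (orderedPairs; handshake-graph; volBlock-sum)
  open EdgeSplitting
  open NatInequalities using (∑-weighted-squares-≤)
  open Modularity
  open import Data.Nat as ℕ using (ℕ; suc; _+_; _*_; _≤_; z≤n; s≤s)
  import Data.Nat.Properties as ℕ
  open import Data.Product using (_,_)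
  open import Data.Fin using (Fin)
  open import Relation.Binary.PropositionalEquality using (_≡_; sym; trans; cong; subst)
  open import Data.Nat.Tactic.RingSolver using (solve-∀)

  G' : Graph n
  G' = deleteEdges G E₀

  G₀ : Graph n
  G₀ = edgeGraph E₀

  m' : ℕ
  m' = numEdges G'

  k : ℕ
  k = edgeCount E₀

  splits : Splits (adj G) (adj G') (adj G₀)
  splits = deleteEdges-splits G E₀

  edges-split : numEdges G ≡ m' + k
  edges-split = splits-edgesWhere splits

  -- A non-empty E₀ contains at least one edge: a related pair is counted by the
  -- handshake identity Σᵢ Σⱼ [ij ∈ E₀] = 2 |E₀|.
  edgeCount-pos : NonEmptyEdges E₀ → 1 ≤ k
  edgeCount-pos (i , j , ij∈E₀) = positive-half k (begin
    1                                   ≡⟨ cong 𝟙 (sym ij∈E₀) ⟩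
    𝟙 (sel E₀ i j)                      ≤⟨ ∑-term-≤ (λ j → 𝟙 (sel E₀ i j)) j ⟩
    ∑[ j < n ] 𝟙 (sel E₀ i j)           ≤⟨ ∑-term-≤ (λ i → ∑[ j < n ] 𝟙 (sel E₀ i j)) i ⟩
    orderedPairs (sel E₀)               ≡⟨ handshake-graph G₀ ⟩
    k + k                               ∎)
    where
    open ℕ.≤-Reasoning
    positive-half : ∀ k → 1 ≤ k + k → 1 ≤ k
    positive-half (suc k) _ = s≤s z≤n

  module ForLabelling (c : Labelling n) where
    private
      module B  = BlockSums G c
      module B' = BlockSums G' c
      module B₀ = BlockSums G₀ c

    x' d S S' : ℕ
    x' = B'.edgesInside
    d  = B₀.edgesInside
    S  = B.squaredVolumes
    S' = B'.squaredVolumes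

    v' w : Fin n → ℕ
    v' = volBlock G' c
    w  = volBlock G₀ c

    volume-split : ∀ A → volBlock G c A ≡ v' A + w A
    volume-split = splits-volBlock {G = G} {G'} {G₀} splits c

    edgesInside-split : B.edgesInside ≡ x' + d
    edgesInside-split =
      trans (sum-cong-≗ (splits-eBlock {G = G} {G'} {G₀} splits c))
            (∑-distrib-+ (eBlock G' c) (eBlock G₀ c))

    S'≤S : S' ≤ S
    S'≤S = ∑-mono-≤ (λ A → ℕ.*-mono-≤ (v'≤v A) (v'≤v A))
      where
      v'≤v : ∀ A → v' A ≤ volBlock G c A
      v'≤v A = subst (v' A ≤_) (sym (volume-split A)) (ℕ.m≤m+n (v' A) (w A))

    -- The volumes of the deleted edges add up to Σ w = 2|E₀|, so the weighted
    -- square bound gives P K S ≤ M K S' + M P (2K)², i.e. P S ≤ M S' + 4 M P K.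
    PS≤ : 1 ≤ k → m' * S ≤ (m' + k) * S' + 4 * (m' + k) * m' * k
    PS≤ 1≤k = ℕ.*-cancelˡ-≤ k {{ℕ.>-nonZero 1≤k}} (begin
      k * (m' * S)
        ≡⟨ trans (swap k m' S) (cong (m' * k *_) (sum-cong-≗ (λ A → cong square (volume-split A)))) ⟩
      m' * k * ∑[ A < n ] ((v' A + w A) * (v' A + w A))
        ≤⟨ ∑-weighted-squares-≤ m' k v' w ⟩
      (m' + k) * k * S' + (m' + k) * m' * (∑[ A < n ] w A * ∑[ A < n ] w A)
        ≡⟨ cong (λ W → (m' + k) * k * S' + (m' + k) * m' * (W * W)) (volBlock-sum G₀ c) ⟩
      (m' + k) * k * S' + (m' + k) * m' * ((k + k) * (k + k))
        ≡⟨ factor m' k S' ⟩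
      k * ((m' + k) * S' + 4 * (m' + k) * m' * k) ∎)
      where
      open ℕ.≤-Reasoning
      square : ℕ → ℕ
      square v = v * v
      swap : ∀ k m S → k * (m * S) ≡ m * k * S
      swap = solve-∀
      factor : ∀ m k S' → (m + k) * k * S' + (m + k) * m * ((k + k) * (k + k))
                          ≡ k * ((m + k) * S' + 4 * (m + k) * m * k)
      factor = solve-∀

    bounds : 1 ≤ k → Bounds m' k x' d S S'
    bounds 1≤k = record
      { K-pos = 1≤k
      ; d≤K   = B₀.edgesInside-≤
      ; x≤P   = B'.edgesInside-≤
      ; S'≤S  = S'≤S
      ; S'≤   = B'.squaredVolumes-≤
      ; 2P≤S' = B'.squaredVolumes-≥
      ; PS≤   = PS≤ 1≤k
      ; S≤    = subst (λ m → S ≤ (m + m) * (m + m)) edges-split B.squaredVolumes-≤-total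
      }

    labelling-close : 1 ≤ k → Close (modularity G c) (modularity G' c) ((2 * k) ÷ numEdges G)
    labelling-close 1≤k
      rewrite modularity-as-value G c | modularity-as-value G' c | edges-split | edgesInside-split
      = values-close m' k x' d S S' (bounds 1≤k)

open import Data.Nat using (ℕ; _*_)
open import Data.Rational using (ℚ; _-_; ∣_∣; _<_)
open import Data.Product using (proj₁; proj₂)
open import Function using (id)
open Maxima using (maxOver-<; ∣-∣-<)
open Modularity using (Close; maxModularity-as-max)

lemma5p1 : ∀ {n : ℕ} (G : Graph n) (E₀ : EdgeSubset G) → NonEmptyEdges E₀ →
  ∣ maxModularity G - maxModularity (deleteEdges G E₀) ∣ < (2 * edgeCount E₀) ÷ numEdges G
lemma5p1 {n} G E₀ nonEmpty
  rewrite maxModularity-as-max G | maxModularity-as-max (deleteEdges G E₀)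
  = ∣-∣-< (maxOver-< (modularity G) (modularity G') ε id (allFuns n n) (λ c → proj₁ (close c)))
          (maxOver-< (modularity G') (modularity G) ε id (allFuns n n) (λ c → proj₂ (close c)))
  where
  open Deletion G E₀ using (G'; edgeCount-pos; module ForLabelling)
  ε : ℚ
  ε = (2 * edgeCount E₀) ÷ numEdges G
  close : ∀ c → Close (modularity G c) (modularity G' c) ε
  close c = ForLabelling.labelling-close c (edgeCount-pos nonEmpty)
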